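{- Let $a,b,c\in\mathbb{N}$ with $a\le b\le c$. Then $f(a,b,c)\ge c-1$.
   Context: $\mathbb{N}$ denotes the positive integers and $[n]=\{1,\dots,n\}$. For $a,b,c\in\mathbb{N}$, $f(a,b,c)$ denotes the metric dimension of the Cartesian product $K_a\times K_b\times K_c$ of complete graphs (vertex set $[a]\times[b]\times[c]$, two triples adjacent iff they differ in exactly one coordinate). Equivalently, $f(a,b,c)$ is the minimum cardinality of a set $Q\subseteq[a]\times[b]\times[c]$ such that for all distinct $s,s'$ there is $q\in Q$ with $g(s,q)\neq g(s',q)$, where $g(s,q)$ is the number of indices $i\in[3]$ with $s_i=q_i$. -}

module Defs where

open import Data.Nat using (ℕ; zero; suc; _+_)
open import Data.Fin using (Fin; _≟_)
open import Data.Product using (_×_; _,_; ∃-syntax)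
open import Data.List using (List)
open import Data.List.Membership.Propositional using (_∈_)
open import Relation.Binary.PropositionalEquality using (_≡_)
open import Relation.Nullary using (¬_; yes; no)

-- Vertices of K_a × K_b × K_c (coordinates indexed from 0 instead of 1).
Vertex : ℕ → ℕ → ℕ → Set
Vertex a b c = Fin a × Fin b × Fin c

agree : ∀ {n} → Fin n → Fin n → ℕ
agree x y with x ≟ y
... | yes _ = 1
... | no  _ = 0

g : ∀ {a b c} → Vertex a b c → Vertex a b c → ℕ
g (s₁ , s₂ , s₃) (q₁ , q₂ , q₃) = agree s₁ q₁ + agree s₂ q₂ + agree s₃ q₃

Resolving : ∀ {a b c} → List (Vertex a b c) → Set
Resolving {a} {b} {c} Q =
  (s s' : Vertex a b c) → ¬ (s ≡ s') → ∃[ q ] (q ∈ Q × ¬ (g s q ≡ g s' q))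

{-# OPTIONS --safe #-}

-- Two vertices (0, 0, k) and (0, 0, k') with k ≢ k' are told apart only by a
-- landmark whose third coordinate is k or k'. So at most one value in Fin c is
-- not the third coordinate of a landmark, and the landmarks have at least c ∸ 1
-- distinct third coordinates.
module Submission where

open import Defs
open import Data.Nat using (ℕ; suc; _≤_; _∸_; NonZero; _+_)
open import Data.Nat.Properties using (module ≤-Reasoning)
open import Data.Fin using (Fin; zero; inject₁; punchIn; _≟_)
open import Data.Fin.Properties
  using (injective⇒≤; inject₁-injective; punchIn-injective; punchInᵢ≢i; all?; ¬∀⟶∃¬)
open import Data.List using (List; length; map; lookup)
open import Data.List.Properties using (length-map)
open import Data.List.Relation.Unary.Any using (index; any?)
open import Data.List.Relation.Unary.Any.Properties using (lookup-index)
open import Data.List.Relation.Unary.Unique.Propositional using (Unique)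
open import Data.List.Membership.Propositional using (_∈_)
open import Data.List.Membership.Propositional.Properties using (∈-map⁺)
open import Data.Product using (_×_; _,_; Σ-syntax)
open import Data.Sum using (_⊎_; inj₁; inj₂)
open import Data.Empty using (⊥-elim)
open import Function.Definitions using (Injective)
open import Level using (Level)
open import Relation.Binary.PropositionalEquality using (_≡_; _≢_; refl; sym; trans; cong; subst)
open import Relation.Nullary using (yes; no)
open import Relation.Unary using (Pred; Decidable)

private
  variable
    ℓ : Level
    B : Set

∈-injection⇒≤length : ∀ {n} {ys : List B} (f : Fin n → B) →
  Injective _≡_ _≡_ f → (∀ i → f i ∈ ys) → n ≤ length ys
∈-injection⇒≤length {ys = ys} f f-inj f∈ys = injective⇒≤ position-injective
  where
  position : ∀ i → f i ≡ lookup ys (index (f∈ys i))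
  position i = lookup-index (f∈ys i)

  position-injective : Injective _≡_ _≡_ (λ i → index (f∈ys i))
  position-injective {i} {j} eq =
    f-inj (trans (position i) (trans (cong (lookup ys) eq) (sym (position j))))

all-but-one⇒injection : ∀ {n} {P : Pred (Fin (suc n)) ℓ} → Decidable P →
  (∀ k k' → k ≢ k' → P k ⊎ P k') →
  Σ[ f ∈ (Fin n → Fin (suc n)) ] Injective _≡_ _≡_ f × (∀ i → P (f i))
all-but-one⇒injection {n = n} {P = P} P? one-of with all? P?
... | yes ∀P = inject₁ , inject₁-injective , λ i → ∀P (inject₁ i)
... | no ¬∀P with ¬∀⟶∃¬ (suc n) P P? ¬∀P
...   | k , ¬Pk = punchIn k , punchIn-injective k _ _ , P-punchIn
  where
  P-punchIn : ∀ i → P (punchIn k i)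
  P-punchIn i with one-of k (punchIn k i) (λ k≡ → punchInᵢ≢i k i (sym k≡))
  ... | inj₁ Pk = ⊥-elim (¬Pk Pk)
  ... | inj₂ P↑i = P↑i

agree-≢⇒≡⊎≡ : ∀ {n} (k k' z : Fin n) → agree k z ≢ agree k' z → k ≡ z ⊎ k' ≡ z
agree-≢⇒≡⊎≡ k k' z agree≢ with k ≟ z | k' ≟ z
... | yes k≡z | _        = inj₁ k≡z
... | no _    | yes k'≡z = inj₂ k'≡z
... | no _    | no _     = ⊥-elim (agree≢ refl)

third : ∀ {a b c} → Vertex a b c → Fin c
third (_ , _ , z) = z

resolving⇒covers-one-of : ∀ {a b c} (Q : List (Vertex (suc a) (suc b) c)) →
  Resolving Q → ∀ k k' → k ≢ k' → k ∈ map third Q ⊎ k' ∈ map third Q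
resolving⇒covers-one-of Q resolving k k' k≢k'
  with resolving (zero , zero , k) (zero , zero , k') (λ eq → k≢k' (cong third eq))
... | (q₁ , q₂ , q₃) , q∈Q , g≢
  with agree-≢⇒≡⊎≡ k k' q₃ (λ eq → g≢ (cong (agree zero q₁ + agree zero q₂ +_) eq))
...   | inj₁ k≡q₃  = inj₁ (subst (_∈ map third Q) (sym k≡q₃) (∈-map⁺ third q∈Q))
...   | inj₂ k'≡q₃ = inj₂ (subst (_∈ map third Q) (sym k'≡q₃) (∈-map⁺ third q∈Q))

corollary1 : (a b c : ℕ) → .{{NonZero a}} → .{{NonZero b}} → .{{NonZero c}} →
    a ≤ b → b ≤ c →
    (Q : List (Vertex a b c)) → Unique Q → Resolving Q → c ∸ 1 ≤ length Q
corollary1 (suc a) (suc b) (suc c) _ _ Q _ resolving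
  with all-but-one⇒injection (λ k → any? (k ≟_) (map third Q))
                             (resolving⇒covers-one-of Q resolving)
... | f , f-injective , f∈third = begin
  c                     ≤⟨ ∈-injection⇒≤length f f-injective f∈third ⟩
  length (map third Q)  ≡⟨ length-map third Q ⟩
  length Q              ∎
  where open ≤-Reasoning
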